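{- For any Boolean function $f:\mathbb{F}_2^n\to\{0,1\}$, $\mathrm{dist}(f,\mathcal{P}_{(111)\text{ -FREE}})\geq\mathrm{dist}(f,\mathcal{P}_{\mathrm{NLTF}})-2^{ -n}$.
   Context: $g:\mathbb{F}_2^n\to\{0,1\}$ is linear if $g(x)+g(y)=g(x+y)$ (mod 2) for all $x,y$; $\mathcal{P}_{\mathrm{LIN}}$ is the set of linear functions. $g$ is triangle-free if for all $x,y$, $(g(x),g(y),g(x+y))\neq(1,1,1)$; $\mathcal{P}_{(111)\text{ -FREE}}$ is the set of such functions, and $\mathcal{P}_{\mathrm{NLTF}}=\mathcal{P}_{(111)\text{ -FREE}}\setminus\mathcal{P}_{\mathrm{LIN}}$. $\mathrm{dist}(f,g)=\Pr_x[f(x)\neq g(x)]$ for uniform $x\in\mathbb{F}_2^n$ and $\mathrm{dist}(f,\mathcal{P})=\min_{g\in\mathcal{P}}\mathrm{dist}(f,g)$. -}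

module Defs where

open import Data.Bool using (Bool; true; false; _xor_; _≟_)
open import Data.Nat using (ℕ; zero; suc; _+_; _≤_)
open import Data.Vec using (Vec; []; _∷_; zipWith)
open import Data.List using (List; []; _∷_; map; _++_; length; filter)
open import Data.Product using (_×_; Σ; ∃)
open import Relation.Nullary using (¬_)
open import Relation.Nullary.Decidable using (¬?)
open import Relation.Binary.PropositionalEquality using (_≡_)

F2^ : ℕ → Set
F2^ n = Vec Bool n

_⊕_ : ∀ {n} → F2^ n → F2^ n → F2^ n
_⊕_ = zipWith _xor_

-- Boolean functions F₂ⁿ → {0,1}  (false = 0, true = 1)
BoolFun : ℕ → Set
BoolFun n = F2^ n → Bool

IsLinear : ∀ {n} → BoolFun n → Set
IsLinear g = ∀ x y → (g x xor g y) ≡ g (x ⊕ y)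

IsTriangleFree : ∀ {n} → BoolFun n → Set
IsTriangleFree g = ∀ x y → ¬ (g x ≡ true × g y ≡ true × g (x ⊕ y) ≡ true)

IsNLTF : ∀ {n} → BoolFun n → Set
IsNLTF g = IsTriangleFree g × ¬ IsLinear g

allPoints : (n : ℕ) → List (F2^ n)
allPoints zero = [] ∷ []
allPoints (suc n) = map (false ∷_) (allPoints n) ++ map (true ∷_) (allPoints n)

-- number of points where f and g differ; dist(f,g) = disagree f g / 2ⁿ
disagree : ∀ {n} → BoolFun n → BoolFun n → ℕ
disagree {n} f g = length (filter (λ x → ¬? (f x ≟ g x)) (allPoints n))

-- In counting form: given a triangle-free g (and assuming some non-linear
-- triangle-free function exists), we produce a non-linear triangle-free h
-- with disagree f h ≤ disagree f g + 1.  If g itself is non-linear, take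
-- h = g.  Otherwise g is linear, and we change g at a single point:
--   * if g x = 1 for some x, set g x := 0; the result lies below g, hence is
--     still triangle-free;
--   * if g ≡ 0, set g e := 1 at a nonzero e; a function supported on one
--     nonzero point is triangle-free.
-- In dimension ≥ 2 any single-point change of a linear function is
-- non-linear, and a single-point change moves the disagreement count by at
-- most one, because every point occurs exactly once in the enumeration.
-- In dimensions 0 and 1 every triangle-free function is linear, so the
-- hypothesis that an NLTF function exists is contradictory there.
module Submission where

open import Defs
open import Data.Nat using (ℕ; _+_; _≤_)
open import Data.Product using (_×_; Σ; ∃)

open import Data.Nat using (zero; suc; z≤n; s≤s)
open import Data.Nat.Properties using (≤-trans; ≤-reflexive; +-mono-≤; +-monoʳ-≤; +-suc; n≤1+n; m≤m+n; ≤-refl)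
open import Data.Bool using (Bool; true; false; _xor_; if_then_else_) renaming (_≟_ to _≟ᴮ_)
open import Data.Bool.Properties using (xor-assoc; xor-same; xor-identityˡ; xor-identityʳ; ¬-not)
open import Data.Vec using ([]; _∷_; replicate)
open import Data.Vec.Properties using (zipWith-assoc; zipWith-identityˡ; zipWith-identityʳ; ∷-injectiveʳ; ≡-dec)
open import Data.List using (List; []; _∷_; map; length; filter)
open import Data.List.Membership.Propositional using (_∈_)
open import Data.List.Membership.Propositional.Properties using (∈-map⁺; ∈-map⁻; ∈-++⁺ˡ; ∈-++⁺ʳ)
open import Data.List.Relation.Unary.All as All using (All; all?)
open import Data.List.Relation.Unary.All.Properties using (all-filter; ¬All⇒Any¬)
open import Data.List.Relation.Unary.Any using (here; satisfied)
open import Data.List.Relation.Unary.Unique.Propositional using (Unique)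
open import Data.List.Relation.Unary.AllPairs using ([]; _∷_)
open import Data.List.Relation.Binary.Disjoint.Propositional using (Disjoint)
import Data.List.Relation.Unary.Unique.Propositional.Properties as Unique
open import Data.Product using (_,_)
open import Data.Sum using (_⊎_; inj₁; inj₂; [_,_])
open import Data.Empty using (⊥-elim)
open import Relation.Nullary using (¬_; Dec; yes; no; does)
open import Relation.Nullary.Decidable using (¬?)
open import Relation.Unary using (Decidable)
open import Relation.Binary.PropositionalEquality using (_≡_; _≢_; refl; sym; trans; cong; cong₂; module ≡-Reasoning)

open ≡-Reasoning

zeros : ∀ {n} → F2^ n
zeros = replicate _ false

⊕-assoc : ∀ {n} (x y z : F2^ n) → (x ⊕ y) ⊕ z ≡ x ⊕ (y ⊕ z)
⊕-assoc = zipWith-assoc xor-assoc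

⊕-identityˡ : ∀ {n} (x : F2^ n) → zeros ⊕ x ≡ x
⊕-identityˡ = zipWith-identityˡ xor-identityˡ

⊕-identityʳ : ∀ {n} (x : F2^ n) → x ⊕ zeros ≡ x
⊕-identityʳ = zipWith-identityʳ xor-identityʳ

⊕-self : ∀ {n} (x : F2^ n) → x ⊕ x ≡ zeros
⊕-self []      = refl
⊕-self (a ∷ x) = cong₂ _∷_ (xor-same a) (⊕-self x)

⊕-cancelʳ : ∀ {n} (x d : F2^ n) → (x ⊕ d) ⊕ d ≡ x
⊕-cancelʳ x d = begin
  (x ⊕ d) ⊕ d   ≡⟨ ⊕-assoc x d d ⟩
  x ⊕ (d ⊕ d)   ≡⟨ cong (x ⊕_) (⊕-self d) ⟩
  x ⊕ zeros     ≡⟨ ⊕-identityʳ x ⟩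
  x             ∎

⊕-fixes⇒zero : ∀ {n} (x d : F2^ n) → x ⊕ d ≡ x → d ≡ zeros
⊕-fixes⇒zero x d x⊕d≡x = begin
  d               ≡⟨ sym (⊕-identityˡ d) ⟩
  zeros ⊕ d       ≡⟨ cong (_⊕ d) (sym (⊕-self x)) ⟩
  (x ⊕ x) ⊕ d     ≡⟨ ⊕-assoc x x d ⟩
  x ⊕ (x ⊕ d)     ≡⟨ cong (x ⊕_) x⊕d≡x ⟩
  x ⊕ x           ≡⟨ ⊕-self x ⟩
  zeros           ∎

avoiding-point : ∀ {m} (x : F2^ (suc (suc m))) → Σ (F2^ (suc (suc m))) (λ d → d ≢ zeros × d ≢ x)
avoiding-point (false ∷ _) = true ∷ false ∷ zeros , (λ ()) , (λ ())
avoiding-point (true ∷ _)  = false ∷ true ∷ zeros , (λ ()) , (λ ())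

_≟ⱽ_ : ∀ {n} (x y : F2^ n) → Dec (x ≡ y)
_≟ⱽ_ = ≡-dec _≟ᴮ_

update : ∀ {n} → BoolFun n → F2^ n → Bool → BoolFun n
update g x b z = if does (z ≟ⱽ x) then b else g z

update-at : ∀ {n} (g : BoolFun n) x b → update g x b x ≡ b
update-at g x b with x ≟ⱽ x
... | yes _   = refl
... | no x≢x = ⊥-elim (x≢x refl)

update-elsewhere : ∀ {n} (g : BoolFun n) {x} b {z} → z ≢ x → update g x b z ≡ g z
update-elsewhere g {x} b {z} z≢x with z ≟ⱽ x
... | yes z≡x = ⊥-elim (z≢x z≡x)
... | no _    = refl

allPoints-complete : ∀ n (x : F2^ n) → x ∈ allPoints n
allPoints-complete zero    []          = here refl
allPoints-complete (suc n) (false ∷ x) = ∈-++⁺ˡ (∈-map⁺ (false ∷_) (allPoints-complete n x))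
allPoints-complete (suc n) (true ∷ x)  =
  ∈-++⁺ʳ (map (false ∷_) (allPoints n)) (∈-map⁺ (true ∷_) (allPoints-complete n x))

allPoints-unique : ∀ n → Unique (allPoints n)
allPoints-unique zero    = All.[] ∷ []
allPoints-unique (suc n) =
  Unique.++⁺ (Unique.map⁺ ∷-injectiveʳ (allPoints-unique n))
             (Unique.map⁺ ∷-injectiveʳ (allPoints-unique n))
             halves-disjoint
  where
  halves-disjoint : Disjoint (map (false ∷_) (allPoints n)) (map (true ∷_) (allPoints n))
  halves-disjoint (v∈₀ , v∈₁) with ∈-map⁻ (false ∷_) v∈₀ | ∈-map⁻ (true ∷_) v∈₁
  ... | _ , _ , refl | _ , _ , ()

unique-constant-length≤1 : ∀ {A : Set} {x : A} {xs : List A} → Unique xs → All (_≡ x) xs → length xs ≤ 1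
unique-constant-length≤1 {xs = []}         _ _ = z≤n
unique-constant-length≤1 {xs = _ ∷ []}     _ _ = ≤-refl
unique-constant-length≤1 {xs = _ ∷ _ ∷ _} ((a≢b All.∷ _) ∷ _) (a≡x All.∷ b≡x All.∷ _) =
  ⊥-elim (a≢b (trans a≡x (sym b≡x)))

occurrences≤1 : ∀ {n} (x : F2^ n) → length (filter (_≟ⱽ x) (allPoints n)) ≤ 1
occurrences≤1 {n} x =
  unique-constant-length≤1 (Unique.filter⁺ (_≟ⱽ x) (allPoints-unique n)) (all-filter (_≟ⱽ x) (allPoints n))

filter-∷-length : ∀ {A : Set} {P : A → Set} (P? : Decidable P) z zs →
  length (filter P? zs) ≤ length (filter P? (z ∷ zs))
filter-∷-length P? z zs with does (P? z)
... | true  = n≤1+n _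
... | false = ≤-refl

module _ {A : Set} {P Q R : A → Set} (P? : Decidable P) (Q? : Decidable Q) (R? : Decidable R)
         (cover : ∀ z → P z → Q z ⊎ R z) where

  filter-cover : ∀ xs → length (filter P? xs) ≤ length (filter Q? xs) + length (filter R? xs)
  filter-cover [] = z≤n
  filter-cover (z ∷ zs) with P? z
  ... | no _ = ≤-trans (filter-cover zs) (+-mono-≤ (filter-∷-length Q? z zs) (filter-∷-length R? z zs))
  ... | yes Pz with Q? z
  ...   | yes _ = s≤s (≤-trans (filter-cover zs) (+-monoʳ-≤ _ (filter-∷-length R? z zs)))
  ...   | no ¬Qz with R? z
  ...     | yes _  = ≤-trans (s≤s (filter-cover zs)) (≤-reflexive (sym (+-suc _ _)))
  ...     | no ¬Rz = ⊥-elim ([ ¬Qz , ¬Rz ] (cover z Pz))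

disagree-update : ∀ {n} (f g : BoolFun n) x b → disagree f (update g x b) ≤ disagree f g + 1
disagree-update {n} f g x b =
  ≤-trans (filter-cover (λ z → ¬? (f z ≟ᴮ update g x b z)) (λ z → ¬? (f z ≟ᴮ g z)) (_≟ⱽ x)
                        disagrees-with-g-or-at-x (allPoints n))
          (+-monoʳ-≤ (disagree f g) (occurrences≤1 x))
  where
  disagrees-with-g-or-at-x : ∀ z → f z ≢ update g x b z → f z ≢ g z ⊎ z ≡ x
  disagrees-with-g-or-at-x z f≢h with z ≟ⱽ x
  ... | yes z≡x = inj₂ z≡x
  ... | no _    = inj₁ f≢h   -- away from x, update g x b z computes to g z

search : ∀ {n} {P : F2^ n → Set} → (∀ x → Dec (P x)) → (∀ x → P x) ⊎ ∃ (λ x → ¬ P x)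
search {n} P? with all? P? (allPoints n)
... | yes all = inj₁ (λ x → All.lookup all (allPoints-complete n x))
... | no ¬all = inj₂ (satisfied (¬All⇒Any¬ P? (allPoints n) ¬all))

∀? : ∀ {n} {P : F2^ n → Set} → (∀ x → Dec (P x)) → Dec (∀ x → P x)
∀? P? with search P?
... | inj₁ all       = yes all
... | inj₂ (x , ¬Px) = no (λ all → ¬Px (all x))

linear? : ∀ {n} (g : BoolFun n) → Dec (IsLinear g)
linear? g = ∀? (λ x → ∀? (λ y → (g x xor g y) ≟ᴮ g (x ⊕ y)))

-- Triangle-free functions vanish at zero (take x = y = 0).
triangleFree-zero : ∀ {n} (h : BoolFun n) → IsTriangleFree h → h zeros ≡ false
triangleFree-zero h tf = ¬-not (λ h0 → tf zeros zeros (h0 , h0 , trans (cong h (⊕-self zeros)) h0))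

-- In dimension ≤ 1 every pair (x, y) has x = 0, y = 0 or x = y, so a
-- function vanishing at zero is automatically linear.
triangleFree⇒linear-dim≤1 : ∀ {n} → n ≤ 1 → (h : BoolFun n) → IsTriangleFree h → IsLinear h
triangleFree⇒linear-dim≤1 z≤n h tf [] [] = trans (xor-same (h [])) (sym (triangleFree-zero h tf))
triangleFree⇒linear-dim≤1 (s≤s z≤n) h tf (false ∷ []) (_ ∷ []) = cong (_xor h _) (triangleFree-zero h tf)
triangleFree⇒linear-dim≤1 (s≤s z≤n) h tf (true ∷ []) (false ∷ []) =
  trans (cong (h (true ∷ []) xor_) (triangleFree-zero h tf)) (xor-identityʳ _)
triangleFree⇒linear-dim≤1 (s≤s z≤n) h tf (true ∷ []) (true ∷ []) =
  trans (xor-same (h (true ∷ []))) (sym (triangleFree-zero h tf))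

no-NLTF-dim≤1 : ∀ {n} → n ≤ 1 → ¬ Σ (BoolFun n) IsNLTF
no-NLTF-dim≤1 n≤1 (h , tf , nonlinear) = nonlinear (triangleFree⇒linear-dim≤1 n≤1 h tf)

triangleFree-downward : ∀ {n} {g h : BoolFun n} → IsTriangleFree g →
  (∀ a → h a ≡ true → g a ≡ true) → IsTriangleFree h
triangleFree-downward tf h≤g a b (ha , hb , hab) = tf a b (h≤g a ha , h≤g b hb , h≤g _ hab)

-- A function supported on a single nonzero point e is triangle-free,
-- since a triangle on e would force e = e ⊕ e = 0.
singleton-triangleFree : ∀ {n} {h : BoolFun n} {e} → e ≢ zeros →
  (∀ a → h a ≡ true → a ≡ e) → IsTriangleFree h
singleton-triangleFree {e = e} e≢0 support a b (ha , hb , hab) = e≢0 (begin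
  e       ≡⟨ sym (support _ hab) ⟩
  a ⊕ b   ≡⟨ cong₂ _⊕_ (support a ha) (support b hb) ⟩
  e ⊕ e   ≡⟨ ⊕-self e ⟩
  zeros   ∎)

-- In dimension ≥ 2, changing a linear function at one point destroys
-- linearity: with d ∉ {0, x}, linearity of both g and h on the pair
-- (x ⊕ d, d) forces h x = g x, since h agrees with g at x ⊕ d and at d.
update-breaks-linearity : ∀ {m} (g : BoolFun (suc (suc m))) x b →
  IsLinear g → b ≢ g x → ¬ IsLinear (update g x b)
update-breaks-linearity g x b linear b≢gx linear′ with avoiding-point x
... | d , d≢0 , d≢x = b≢gx (begin
  b                          ≡⟨ sym (update-at g x b) ⟩
  h x                        ≡⟨ cong h (sym (⊕-cancelʳ x d)) ⟩
  h ((x ⊕ d) ⊕ d)            ≡⟨ sym (linear′ (x ⊕ d) d) ⟩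
  h (x ⊕ d) xor h d          ≡⟨ cong₂ _xor_ (update-elsewhere g b x⊕d≢x) (update-elsewhere g b d≢x) ⟩
  g (x ⊕ d) xor g d          ≡⟨ linear (x ⊕ d) d ⟩
  g ((x ⊕ d) ⊕ d)            ≡⟨ cong g (⊕-cancelʳ x d) ⟩
  g x                        ∎)
  where
  h : BoolFun _
  h = update g x b
  x⊕d≢x : x ⊕ d ≢ x
  x⊕d≢x eq = d≢0 (⊕-fixes⇒zero x d eq)

true≢false : true ≢ false
true≢false ()

linear-flip-NLTF : ∀ {m} (g : BoolFun (suc (suc m))) → IsLinear g → IsTriangleFree g →
  Σ (F2^ (suc (suc m))) (λ x → Σ Bool (λ b → IsNLTF (update g x b)))
linear-flip-NLTF g linear tf with search (λ x → g x ≟ᴮ false)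
... | inj₂ (x , gx≢false) =
  x , false , triangleFree-downward tf below-g , update-breaks-linearity g x false linear (λ eq → gx≢false (sym eq))
  where
  below-g : ∀ a → update g x false a ≡ true → g a ≡ true
  below-g a ha with a ≟ⱽ x
  ... | yes _ = ⊥-elim (true≢false (sym ha))   -- at x the update computes to false
  ... | no _  = ha                              -- elsewhere it computes to g a
... | inj₁ g≡0 =
  e , true , singleton-triangleFree e≢0 supported-at-e , update-breaks-linearity g e true linear (λ eq → true≢false (trans eq (g≡0 e)))
  where
  e : F2^ (suc (suc _))
  e = true ∷ false ∷ zeros
  e≢0 : e ≢ zeros
  e≢0 ()
  supported-at-e : ∀ a → update g e true a ≡ true → a ≡ e
  supported-at-e a ha with a ≟ⱽ e
  ... | yes a≡e = a≡e
  ... | no _    = ⊥-elim (true≢false (trans (sym ha) (g≡0 a)))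

proposition4p7 : (n : ℕ) → (f : BoolFun n) →
    Σ (BoolFun n) IsNLTF →
    (g : BoolFun n) → IsTriangleFree g →
    Σ (BoolFun n) (λ h → IsNLTF h × disagree f h ≤ disagree f g + 1)
proposition4p7 zero          f nltf _ _ = ⊥-elim (no-NLTF-dim≤1 z≤n nltf)
proposition4p7 (suc zero)    f nltf _ _ = ⊥-elim (no-NLTF-dim≤1 (s≤s z≤n) nltf)
proposition4p7 (suc (suc m)) f _ g tf with linear? g
... | no nonlinear = g , (tf , nonlinear) , m≤m+n (disagree f g) 1
... | yes linear with linear-flip-NLTF g linear tf
...   | x , b , nltf = update g x b , nltf , disagree-update f g x b
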